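{- In every $\omega$-quantale $Q$, for all $0\le i<j<\omega$ and all $\alpha,\beta$: (1) $\mathit{dom}_i(\alpha)\cdot_i\beta^{\ast_j}\le(\mathit{dom}_i(\alpha)\cdot_i\beta)^{\ast_j}$ and $\alpha^{\ast_j}\cdot_i\mathit{cod}_i(\beta)\le(\alpha\cdot_i\mathit{cod}_i(\beta))^{\ast_j}$; (2) if $Q$ is strong, $\mathit{dom}_j(\alpha)\cdot_i\beta^{\ast_j}\le(\mathit{dom}_j(\alpha)\cdot_i\beta)^{\ast_j}$ and $\alpha^{\ast_j}\cdot_i\mathit{cod}_j(\beta)\le(\alpha\cdot_i\mathit{cod}_j(\beta))^{\ast_j}$; (3) $(\alpha\cdot_j\beta)^{\ast_i}\le\alpha^{\ast_i}\cdot_j\beta^{\ast_i}$.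
   Context: A modal quantale is a quantale $(Q,\le,\cdot,1)$ (complete lattice with associative multiplication preserving all sups in both arguments, with unit $1$) with $\mathit{dom},\mathit{cod}:Q\to Q$ such that $\alpha\le\mathit{dom}(\alpha)\alpha$, $\mathit{dom}(\alpha\mathit{dom}(\beta))=\mathit{dom}(\alpha\beta)$, $\mathit{dom}(\alpha)\le1$, $\mathit{dom}(\bot)=\bot$, $\mathit{dom}(\alpha\vee\beta)=\mathit{dom}(\alpha)\vee\mathit{dom}(\beta)$, the opposite axioms for $\mathit{cod}$, and $\mathit{dom}\circ\mathit{cod}=\mathit{cod}$, $\mathit{cod}\circ\mathit{dom}=\mathit{dom}$. An $\omega$-quantale is $(Q,\le,\cdot_i,1_i,\mathit{dom}_i,\mathit{cod}_i)_{0\le i<\omega}$ with each component a modal quantale on the same lattice, such that for $i\ne j$: $\mathit{dom}_i(\alpha\cdot_j\beta)\le\mathit{dom}_i(\alpha)\cdot_j\mathit{dom}_i(\beta)$, $\mathit{cod}_i(\alpha\cdot_j\beta)\le\mathit{cod}_i(\alpha)\cdot_j\mathit{cod}_i(\beta)$; for $i<j$: $(\alpha\cdot_j\beta)\cdot_i(\gamma\cdot_j\delta)\le(\alpha\cdot_i\gamma)\cdot_j(\beta\cdot_i\delta)$ and $\mathit{dom}_j\circ\mathit{dom}_i=\mathit{dom}_i$. Strong: for $i<j$, $\mathit{dom}_j(\alpha\cdot_i\beta)=\mathit{dom}_j(\alpha)\cdot_i\mathit{dom}_j(\beta)$, $\mathit{cod}_j(\alpha\cdot_i\beta)=\mathit{cod}_j(\alpha)\cdot_i\mathit{cod}_j(\beta)$.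 The star is $\alpha^{\ast_k}=\bigvee_{n\ge0}\alpha^{n_k}$ where $\alpha^{0_k}=1_k$ and $\alpha^{(n+1)_k}=\alpha\cdot_k\alpha^{n_k}$. -}

module Defs where

open import Level using (Level; Lift; lift; _⊔_) renaming (suc to lsuc)
open import Data.Nat using (ℕ; zero; suc; _<_)
open import Data.Bool using (Bool; true; false)
open import Data.Empty using (⊥)
open import Data.Product using (_×_)
open import Relation.Binary.PropositionalEquality using (_≡_; _≢_)

record IsCompleteLattice {c ℓ ι : Level} (Carrier : Set c)
         (_≤_ : Carrier → Carrier → Set ℓ)
         (⋁ : {I : Set ι} → (I → Carrier) → Carrier) : Set (c ⊔ ℓ ⊔ lsuc ι) where
  field
    refl≤   : ∀ x → x ≤ x
    trans≤  : ∀ {x y z} → x ≤ y → y ≤ z → x ≤ z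
    antisym : ∀ {x y} → x ≤ y → y ≤ x → x ≡ y
    ⋁-ub    : ∀ {I : Set ι} (f : I → Carrier) (i : I) → f i ≤ ⋁ f
    ⋁-least : ∀ {I : Set ι} (f : I → Carrier) (x : Carrier) → (∀ i → f i ≤ x) → ⋁ f ≤ x

module _ {c ι : Level} {Carrier : Set c} (⋁ : {I : Set ι} → (I → Carrier) → Carrier) where
  bot : Carrier
  bot = ⋁ {Lift ι ⊥} (λ ())

  join : Carrier → Carrier → Carrier
  join x y = ⋁ {Lift ι Bool} (λ { (lift true) → x ; (lift false) → y })

record IsModalQuantale {c ℓ ι : Level} (Carrier : Set c)
         (_≤_ : Carrier → Carrier → Set ℓ)
         (⋁ : {I : Set ι} → (I → Carrier) → Carrier)
         (_·_ : Carrier → Carrier → Carrier) (one : Carrier)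
         (dom cod : Carrier → Carrier) : Set (c ⊔ ℓ ⊔ lsuc ι) where
  private
    _∨_ = join ⋁
    ⊥' = bot ⋁
  field
    ·-assoc : ∀ x y z → (x · y) · z ≡ x · (y · z)
    ·-idˡ   : ∀ x → one · x ≡ x
    ·-idʳ   : ∀ x → x · one ≡ x
    ·-⋁ˡ    : ∀ {I : Set ι} (f : I → Carrier) (x : Carrier) → ⋁ f · x ≡ ⋁ (λ i → f i · x)
    ·-⋁ʳ    : ∀ {I : Set ι} (x : Carrier) (f : I → Carrier) → x · ⋁ f ≡ ⋁ (λ i → x · f i)
    dom-absorb : ∀ α → α ≤ (dom α · α)
    dom-local  : ∀ α β → dom (α · dom β) ≡ dom (α · β)
    dom-sub1   : ∀ α → dom α ≤ one
    dom-bot    : dom ⊥' ≡ ⊥'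
    dom-join   : ∀ α β → dom (α ∨ β) ≡ (dom α ∨ dom β)
    cod-absorb : ∀ α → α ≤ (α · cod α)
    cod-local  : ∀ α β → cod (cod α · β) ≡ cod (α · β)
    cod-sub1   : ∀ α → cod α ≤ one
    cod-bot    : cod ⊥' ≡ ⊥'
    cod-join   : ∀ α β → cod (α ∨ β) ≡ (cod α ∨ cod β)
    dom-cod    : ∀ α → dom (cod α) ≡ cod α
    cod-dom    : ∀ α → cod (dom α) ≡ dom α

record OmegaQuantale (c ℓ ι : Level) : Set (lsuc (c ⊔ ℓ ⊔ ι)) where
  infix 4 _≤_
  field
    Carrier : Set c
    _≤_     : Carrier → Carrier → Set ℓ
    ⋁       : {I : Set ι} → (I → Carrier) → Carrier
    isCompleteLattice : IsCompleteLattice Carrier _≤_ ⋁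
    mul  : ℕ → Carrier → Carrier → Carrier
    one  : ℕ → Carrier
    dom  : ℕ → Carrier → Carrier
    cod  : ℕ → Carrier → Carrier
    isModalQuantale : ∀ i → IsModalQuantale Carrier _≤_ ⋁ (mul i) (one i) (dom i) (cod i)
    dom-mul : ∀ i j → i ≢ j → ∀ α β → dom i (mul j α β) ≤ mul j (dom i α) (dom i β)
    cod-mul : ∀ i j → i ≢ j → ∀ α β → cod i (mul j α β) ≤ mul j (cod i α) (cod i β)
    interchange : ∀ i j → i < j → ∀ α β γ δ →
      mul i (mul j α β) (mul j γ δ) ≤ mul j (mul i α γ) (mul i β δ)
    dom-dom : ∀ i j → i < j → ∀ α → dom j (dom i α) ≡ dom i α

module _ {c ℓ ι : Level} (Q : OmegaQuantale c ℓ ι) where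
  open OmegaQuantale Q

  IsStrong : Set c
  IsStrong = ∀ i j → i < j → ∀ α β →
    (dom j (mul i α β) ≡ mul i (dom j α) (dom j β)) ×
    (cod j (mul i α β) ≡ mul i (cod j α) (cod j β))

  pow : ℕ → Carrier → ℕ → Carrier
  pow k α zero    = one k
  pow k α (suc n) = mul k α (pow k α n)

  star : ℕ → Carrier → Carrier
  star k α = ⋁ {Lift ι ℕ} (λ { (lift n) → pow k α n })

-- Each part is proved power by power and then taken to the supremum.  For (1) and (2),
-- an element d with dom_j d = d and d ·_i 1_j ≤ 1_j satisfies d ≤ d ·_j d, so interchange
-- gives d ·_i (β ·_j β^n) ≤ (d ·_i β) ·_j (d ·_i β^n).  For d = dom_i α the bound
-- d ·_i 1_j ≤ 1_j holds because d ≤ 1_i; for d = dom_j α strongness makes d ·_i 1_j itself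
-- a j-domain element.  For (3), interchange directly gives (α ·_j β)^n ≤ α^n ·_j β^n.
{-# OPTIONS --safe #-}
module Submission where

open import Defs
open import Level using (Level; lift)
open import Data.Nat using (zero; suc; _<_)
open import Data.Bool using (true; false)
open import Data.Product using (_×_; _,_; proj₁)
open import Relation.Binary.PropositionalEquality using (_≡_; refl; sym; cong; cong₂; subst)
open Relation.Binary.PropositionalEquality.≡-Reasoning

module CompleteLatticeProperties
    {c ℓ ι : Level} {A : Set c} {_≤_ : A → A → Set ℓ} {⋁ : {I : Set ι} → (I → A) → A}
    (L : IsCompleteLattice A _≤_ ⋁) where
  open IsCompleteLattice L

  ≤-reflexive : ∀ {x y} → x ≡ y → x ≤ y
  ≤-reflexive {x} refl = refl≤ x

  ≤⇒join≡ʳ : ∀ {x y} → x ≤ y → join ⋁ x y ≡ y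
  ≤⇒join≡ʳ {x} {y} x≤y =
    antisym (⋁-least _ y (λ { (lift true) → x≤y ; (lift false) → refl≤ y })) (⋁-ub _ (lift false))

module ModalQuantaleProperties
    {c ℓ ι : Level} {A : Set c} {_≤_ : A → A → Set ℓ} {⋁ : {I : Set ι} → (I → A) → A}
    {_·_ : A → A → A} {one : A} {dom cod : A → A}
    (L : IsCompleteLattice A _≤_ ⋁) (M : IsModalQuantale A _≤_ ⋁ _·_ one dom cod) where
  open IsCompleteLattice L
  open IsModalQuantale M
  open CompleteLatticeProperties L

  ·-monoˡ : ∀ {x y} z → x ≤ y → (x · z) ≤ (y · z)
  ·-monoˡ {x} {y} z x≤y = trans≤ (⋁-ub _ (lift true)) (≤-reflexive (begin
    ⋁ _              ≡⟨ sym (·-⋁ˡ _ z) ⟩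
    join ⋁ x y · z   ≡⟨ cong (_· z) (≤⇒join≡ʳ x≤y) ⟩
    y · z            ∎))

  ·-monoʳ : ∀ z {x y} → x ≤ y → (z · x) ≤ (z · y)
  ·-monoʳ z {x} {y} x≤y = trans≤ (⋁-ub _ (lift true)) (≤-reflexive (begin
    ⋁ _              ≡⟨ sym (·-⋁ʳ z _) ⟩
    z · join ⋁ x y   ≡⟨ cong (z ·_) (≤⇒join≡ʳ x≤y) ⟩
    z · y            ∎))

  ·-mono : ∀ {x x′ y y′} → x ≤ x′ → y ≤ y′ → (x · y) ≤ (x′ · y′)
  ·-mono {x′ = x′} {y = y} x≤x′ y≤y′ = trans≤ (·-monoˡ y x≤x′) (·-monoʳ x′ y≤y′)

  ·-⋁ʳ-least : ∀ {I : Set ι} x (f : I → A) y → (∀ i → (x · f i) ≤ y) → (x · ⋁ f) ≤ y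
  ·-⋁ʳ-least x f y bound = trans≤ (≤-reflexive (·-⋁ʳ x f)) (⋁-least _ y bound)

  ·-⋁ˡ-least : ∀ {I : Set ι} (f : I → A) x y → (∀ i → (f i · x) ≤ y) → (⋁ f · x) ≤ y
  ·-⋁ˡ-least f x y bound = trans≤ (≤-reflexive (·-⋁ˡ f x)) (⋁-least _ y bound)

  subidentity-·ˡ : ∀ {p} x → p ≤ one → (p · x) ≤ x
  subidentity-·ˡ x p≤one = trans≤ (·-monoˡ x p≤one) (≤-reflexive (·-idˡ x))

  subidentity-·ʳ : ∀ {p} x → p ≤ one → (x · p) ≤ x
  subidentity-·ʳ x p≤one = trans≤ (·-monoʳ x p≤one) (≤-reflexive (·-idʳ x))

  dom-idem : ∀ x → dom (dom x) ≡ dom x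
  dom-idem x = begin
    dom (dom x)         ≡⟨ cong dom (sym (·-idˡ (dom x))) ⟩
    dom (one · dom x)   ≡⟨ dom-local one x ⟩
    dom (one · x)       ≡⟨ cong dom (·-idˡ x) ⟩
    dom x               ∎

  dom-one : dom one ≡ one
  dom-one = antisym (dom-sub1 one) (trans≤ (dom-absorb one) (≤-reflexive (·-idʳ (dom one))))

  dom-fixed⇒≤one : ∀ {p} → dom p ≡ p → p ≤ one
  dom-fixed⇒≤one {p} dp≡p = subst (_≤ one) dp≡p (dom-sub1 p)

  dom-fixed⇒≤square : ∀ {p} → dom p ≡ p → p ≤ (p · p)
  dom-fixed⇒≤square {p} dp≡p = subst (λ d → p ≤ (d · p)) dp≡p (dom-absorb p)

module OmegaQuantaleProperties {c ℓ ι : Level} (Q : OmegaQuantale c ℓ ι) where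
  open OmegaQuantale Q
  open IsCompleteLattice isCompleteLattice
  open CompleteLatticeProperties isCompleteLattice
  module M k = IsModalQuantale (isModalQuantale k)
  module P k = ModalQuantaleProperties isCompleteLattice (isModalQuantale k)

  pow≤star : ∀ k x n → pow Q k x n ≤ star Q k x
  pow≤star k x n = ⋁-ub _ (lift n)

  star-least : ∀ k x y → (∀ n → pow Q k x n ≤ y) → star Q k x ≤ y
  star-least k x y bound = ⋁-least _ y (λ { (lift n) → bound n })

  dom-fixed-lift : ∀ {i j} → i < j → ∀ {p} → dom i p ≡ p → dom j p ≡ p
  dom-fixed-lift {i} {j} i<j {p} dp≡p = begin
    dom j p           ≡⟨ cong (dom j) (sym dp≡p) ⟩
    dom j (dom i p)   ≡⟨ dom-dom i j i<j p ⟩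
    dom i p           ≡⟨ dp≡p ⟩
    p                 ∎

  ·-starˡ : ∀ {i j} → i < j → ∀ {d} β → dom j d ≡ d → mul i d (one j) ≤ one j →
    mul i d (star Q j β) ≤ star Q j (mul i d β)
  ·-starˡ {i} {j} i<j {d} β djd≡d d·1≤1 =
    P.·-⋁ʳ-least i d _ _ (λ { (lift n) → trans≤ (·-powˡ n) (pow≤star j (mul i d β) n) })
    where
    ·-powˡ : ∀ n → mul i d (pow Q j β n) ≤ pow Q j (mul i d β) n
    ·-powˡ zero    = d·1≤1
    ·-powˡ (suc n) = trans≤ (P.·-monoˡ i _ (P.dom-fixed⇒≤square j djd≡d))
      (trans≤ (interchange i j i<j d d β (pow Q j β n)) (P.·-monoʳ j _ (·-powˡ n)))

  ·-starʳ : ∀ {i j} → i < j → ∀ {e} α → dom j e ≡ e → mul i (one j) e ≤ one j →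
    mul i (star Q j α) e ≤ star Q j (mul i α e)
  ·-starʳ {i} {j} i<j {e} α dje≡e 1·e≤1 =
    P.·-⋁ˡ-least i _ e _ (λ { (lift n) → trans≤ (·-powʳ n) (pow≤star j (mul i α e) n) })
    where
    ·-powʳ : ∀ n → mul i (pow Q j α n) e ≤ pow Q j (mul i α e) n
    ·-powʳ zero    = 1·e≤1
    ·-powʳ (suc n) = trans≤ (P.·-monoʳ i _ (P.dom-fixed⇒≤square j dje≡e))
      (trans≤ (interchange i j i<j α (pow Q j α n) e e) (P.·-monoʳ j _ (·-powʳ n)))

  pow-interchange : ∀ {i j} → i < j → ∀ α β n →
    pow Q i (mul j α β) n ≤ mul j (pow Q i α n) (pow Q i β n)
  pow-interchange {i} {j} i<j α β zero =
    P.dom-fixed⇒≤square j (dom-fixed-lift i<j (P.dom-one i))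
  pow-interchange {i} {j} i<j α β (suc n) =
    trans≤ (P.·-monoʳ i _ (pow-interchange i<j α β n))
      (interchange i j i<j α β (pow Q i α n) (pow Q i β n))

  star-interchange : ∀ {i j} → i < j → ∀ α β →
    star Q i (mul j α β) ≤ mul j (star Q i α) (star Q i β)
  star-interchange {i} {j} i<j α β = star-least i _ _ (λ n →
    trans≤ (pow-interchange i<j α β n) (P.·-mono j (pow≤star i α n) (pow≤star i β n)))

  strong-dom-fixed-·ʳ-one : IsStrong Q → ∀ {i j} → i < j → ∀ {d} → dom j d ≡ d →
    dom j (mul i d (one j)) ≡ mul i d (one j)
  strong-dom-fixed-·ʳ-one strong {i} {j} i<j {d} djd≡d = begin
    dom j (mul i d (one j))           ≡⟨ proj₁ (strong i j i<j d (one j)) ⟩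
    mul i (dom j d) (dom j (one j))   ≡⟨ cong₂ (mul i) djd≡d (P.dom-one j) ⟩
    mul i d (one j)                   ∎

  strong-dom-fixed-·ˡ-one : IsStrong Q → ∀ {i j} → i < j → ∀ {e} → dom j e ≡ e →
    dom j (mul i (one j) e) ≡ mul i (one j) e
  strong-dom-fixed-·ˡ-one strong {i} {j} i<j {e} dje≡e = begin
    dom j (mul i (one j) e)           ≡⟨ proj₁ (strong i j i<j (one j) e) ⟩
    mul i (dom j (one j)) (dom j e)   ≡⟨ cong₂ (mul i) (P.dom-one j) dje≡e ⟩
    mul i (one j) e                   ∎

lemma7p6 : {c ℓ ι : Level} (Q : OmegaQuantale c ℓ ι) →
    let open OmegaQuantale Q in
    ∀ i j → i < j → ∀ α β →
      -- (1)
      ((mul i (dom i α) (star Q j β) ≤ star Q j (mul i (dom i α) β)) ×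
       (mul i (star Q j α) (cod i β) ≤ star Q j (mul i α (cod i β)))) ×
      -- (2)
      (IsStrong Q →
        (mul i (dom j α) (star Q j β) ≤ star Q j (mul i (dom j α) β)) ×
        (mul i (star Q j α) (cod j β) ≤ star Q j (mul i α (cod j β)))) ×
      -- (3)
      (star Q i (mul j α β) ≤ mul j (star Q i α) (star Q i β))
lemma7p6 Q i j i<j α β =
  ( ( ·-starˡ i<j β (dom-fixed-lift i<j (P.dom-idem i α)) (P.subidentity-·ˡ i (one j) (M.dom-sub1 i α))
    , ·-starʳ i<j α (dom-fixed-lift i<j (M.dom-cod i β)) (P.subidentity-·ʳ i (one j) (M.cod-sub1 i β)) )
  , (λ strong →
      ( ·-starˡ i<j β (P.dom-idem j α)
          (P.dom-fixed⇒≤one j (strong-dom-fixed-·ʳ-one strong i<j (P.dom-idem j α)))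
      , ·-starʳ i<j α (M.dom-cod j β)
          (P.dom-fixed⇒≤one j (strong-dom-fixed-·ˡ-one strong i<j (M.dom-cod j β))) ))
  , star-interchange i<j α β )
  where
  open OmegaQuantale Q using (one)
  open OmegaQuantaleProperties Q
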